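{- Let $G$ be a $4$-Ore graph and let $t(H)$ denote the number of triangles of a graph $H$. Then $t(G)\ge 4$. For every vertex $z\in V(G)$, every graph $G_z$ obtained from $G$ by splitting $z$ satisfies $t(G_z)\ge 2$. Furthermore, if $G\neq K_4$ then $t(G-z)\ge 2$ for every $z\in V(G)$, and if $G=K_4$ then $t(G-z)=1$.
   Context: Splitting a vertex $z$ means removing $z$ and adding two new nonadjacent vertices $z_1,z_2$ of positive degree whose neighbourhoods partition the neighbourhood of $z$. An Ore-composition $O(G_1,G_2)$ of vertex-disjoint graphs: delete an edge $xy$ of $G_1$, split a vertex $z$ of $G_2$ into $z_1,z_2$, identify $x$ with $z_1$ and $y$ with $z_2$. A graph is $4$-Ore if it is obtained from a set of copies of $K_4$ by a sequence of Ore-compositions. -}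

module Defs where

open import Data.Nat using (ℕ; zero; suc; pred; _+_; _≤_)
open import Data.Fin using (Fin; zero; suc; toℕ; punchIn; splitAt; _≟_)
open import Data.Bool using (Bool; true; false; _∧_; _∨_; not; if_then_else_)
open import Data.Bool.Properties using (∨-comm)
open import Data.List using (List; map)
open import Data.Nat.ListAction using (sum)
open import Data.List using () renaming (allFin to allFinL)
open import Data.Sum using (_⊎_; inj₁; inj₂)
open import Data.Product using (∃; _×_; _,_)
open import Data.Nat using (_<ᵇ_)
open import Relation.Nullary using (yes; no; ¬_)
open import Relation.Nullary.Decidable using (⌊_⌋)
open import Relation.Binary.PropositionalEquality using (_≡_; refl; sym; cong₂)
open import Function.Bundles using (_↔_; Inverse)

eqF : ∀ {n} → Fin n → Fin n → Bool
eqF a b = ⌊ a ≟ b ⌋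

eqF-sym : ∀ {n} (a b : Fin n) → eqF a b ≡ eqF b a
eqF-sym a b with a ≟ b | b ≟ a
... | yes _ | yes _ = refl
... | no _ | no _ = refl
... | yes p | no q = Data.Empty.⊥-elim (q (sym p)) where import Data.Empty
... | no p | yes q = Data.Empty.⊥-elim (p (sym q)) where import Data.Empty

eqF-refl : ∀ {n} (a : Fin n) → eqF a a ≡ true
eqF-refl a with a ≟ a
... | yes _ = refl
... | no p = Data.Empty.⊥-elim (p refl) where import Data.Empty

record Graph (n : ℕ) : Set where
  field
    E      : Fin n → Fin n → Bool
    E-sym  : ∀ a b → E a b ≡ E b a
    E-irr  : ∀ a → E a a ≡ false
open Graph public

mkGraph : ∀ {n} → (Fin n → Fin n → Bool) → Graph n
mkGraph R = record
  { E = λ a b → (R a b ∨ R b a) ∧ not (eqF a b)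
  ; E-sym = λ a b → cong₂ (λ u v → u ∧ not v) (∨-comm (R a b) (R b a)) (eqF-sym a b)
  ; E-irr = λ a → irr a }
  where
  irr : ∀ a → ((R a a ∨ R a a) ∧ not (eqF a a)) ≡ false
  irr a rewrite eqF-refl a with R a a
  ... | true = refl
  ... | false = refl

K4 : Graph 4
K4 = mkGraph (λ a b → true)

record _≅_ {n n′ : ℕ} (G : Graph n) (H : Graph n′) : Set where
  field
    bij      : Fin n ↔ Fin n′
    preserve : ∀ a b → E H (Inverse.to bij a) (Inverse.to bij b) ≡ E G a b

triangles : ∀ {n} → Graph n → ℕ
triangles {n} G =
  sum (map (λ i → sum (map (λ j → sum (map (λ k →
    if (toℕ i <ᵇ toℕ j) ∧ (toℕ j <ᵇ toℕ k) ∧ E G i j ∧ E G j k ∧ E G i k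
    then 1 else 0) (allFinL n))) (allFinL n))) (allFinL n))

delete : ∀ {n} → Graph n → Fin n → Graph (pred n)
delete {suc m} G z = mkGraph (λ i j → E G (punchIn z i) (punchIn z j))

-- A function side : Fin n → Bool determines a split of z:
-- z₁ gets the neighbours w of z with side w = true,
-- z₂ gets the neighbours w of z with side w = false.
-- The split is valid iff both z₁ and z₂ have positive degree.
IsSplit : ∀ {n} → Graph n → Fin n → (Fin n → Bool) → Set
IsSplit G z side =
  (∃ λ w → E G z w ≡ true × side w ≡ true) ×
  (∃ λ w → E G z w ≡ true × side w ≡ false)

-- The graph G_z obtained by splitting z according to side.
-- Vertex 0 is z₁, vertex 1 is z₂, vertex (2+i) is the old vertex punchIn z i.
split : ∀ {n} → Graph n → Fin n → (Fin n → Bool) → Graph (suc n)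
split {suc m} G z side = mkGraph R
  where
  R : Fin (suc (suc m)) → Fin (suc (suc m)) → Bool
  R zero (suc (suc i)) = E G z (punchIn z i) ∧ side (punchIn z i)
  R (suc zero) (suc (suc i)) = E G z (punchIn z i) ∧ not (side (punchIn z i))
  R (suc (suc i)) (suc (suc j)) = E G (punchIn z i) (punchIn z j)
  R _ _ = false

-- Ore-composition O(G₁,G₂): delete the edge xy of G₁, split z of G₂
-- according to side into z₁,z₂, identify x with z₁ and y with z₂.
-- Vertex set: Fin n₁ (vertices of G₁) ⊎ Fin m (vertices of G₂ other than z,
-- via punchIn z), encoded as Fin (n₁ + m) through splitAt.
oreComp : ∀ {n₁ m} → Graph n₁ → Fin n₁ → Fin n₁ →
          Graph (suc m) → Fin (suc m) → (Fin (suc m) → Bool) → Graph (n₁ + m)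
oreComp {n₁} {m} G₁ x y G₂ z side = mkGraph (λ a b → R (splitAt n₁ a) (splitAt n₁ b))
  where
  R : Fin n₁ ⊎ Fin m → Fin n₁ ⊎ Fin m → Bool
  R (inj₁ a) (inj₁ b) = E G₁ a b ∧ not ((eqF a x ∧ eqF b y) ∨ (eqF a y ∧ eqF b x))
  R (inj₂ i) (inj₂ j) = E G₂ (punchIn z i) (punchIn z j)
  R (inj₁ a) (inj₂ j) =
    (eqF a x ∧ E G₂ z (punchIn z j) ∧ side (punchIn z j)) ∨
    (eqF a y ∧ E G₂ z (punchIn z j) ∧ not (side (punchIn z j)))
  R (inj₂ _) (inj₁ _) = false

data Ore4 : ∀ {n} → Graph n → Set where
  isK4 : ∀ {n} {G : Graph n} → G ≅ K4 → Ore4 G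
  isOre : ∀ {n₁ m} {G₁ : Graph n₁} {G₂ : Graph (suc m)} →
          Ore4 G₁ → Ore4 G₂ →
          (x y : Fin n₁) → E G₁ x y ≡ true →
          (z : Fin (suc m)) (side : Fin (suc m) → Bool) → IsSplit G₂ z side →
          ∀ {n} {G : Graph n} → G ≅ oreComp G₁ x y G₂ z side → Ore4 G

-- Every 4-Ore graph G is "triangle rich": it has four pairwise distinct triangles, every edge is
-- avoided by two distinct triangles, and, unless G ≅ K4, so is every vertex.  For H = O(G₁,G₂)
-- the two triangles of G₁ avoiding the deleted edge xy survive in H, and so do two triangles of
-- the graph obtained by splitting z in G₂; the latter meet G₂ - z and contain at most one of x, y.
-- Hence each edge and vertex of H is avoided by one of these two pairs, except x and y, which are
-- avoided by a triangle of G₁ - x (resp. G₁ - y) together with a triangle of G₂ - z.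
-- Splitting or deleting z keeps the triangles avoiding z.  In K4 a split keeps the face opposite
-- z, and two of its three vertices lie on the same side, spanning a new triangle with z₁ or z₂.

module Submission where

open import Defs
open import Data.Nat using (ℕ; zero; suc; _+_; _≤_; _<_; z≤n; _<ᵇ_)
open import Data.Nat.Properties using (<-cmp; <⇒<ᵇ; +-mono-≤; ≤-reflexive; module ≤-Reasoning)
open import Data.Nat.ListAction using (sum)
open import Data.Nat.ListAction.Properties using (sum-++; sum-↭)
open import Data.Fin using (Fin; zero; suc; #_; toℕ; punchIn; punchOut; splitAt; _↑ˡ_; _↑ʳ_; _≟_)
open import Data.Fin.Properties
  using (toℕ-injective; punchIn-injective; punchIn-punchOut; punchInᵢ≢i; ↑ˡ-injective; ↑ʳ-injective;
         splitAt-↑ˡ; splitAt-↑ʳ; join-splitAt)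
open import Data.Fin.Permutation using (↔⇒≡)
open import Data.Bool using (Bool; true; false; _∧_; _∨_; not; if_then_else_)
open import Data.Bool.Properties using (∨-idem; ∧-idem; ¬-not; T-≡)
open import Data.List using (List; []; _∷_; _++_; map; concatMap; length) renaming (allFin to allFinL)
open import Data.List.Properties using (map-∘; map-cong; map-++; length-map)
open import Data.List.Membership.Propositional using (_∈_; lose)
open import Data.List.Membership.Propositional.Properties using (∈-∃++; ∈-allFin; ∈-map⁺; ∈-concatMap⁺)
open import Data.List.Relation.Unary.All using (All; []; _∷_)
import Data.List.Relation.Unary.All as All
import Data.List.Relation.Unary.All.Properties as All
open import Data.List.Relation.Unary.AllPairs using (AllPairs; []; _∷_)
import Data.List.Relation.Unary.AllPairs as AllPairs
import Data.List.Relation.Unary.AllPairs.Properties as AllPairs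
open import Data.List.Relation.Unary.Any using (here; there)
open import Data.List.Relation.Unary.Unique.Propositional using (Unique)
open import Data.List.Relation.Binary.Permutation.Propositional using (↭-sym)
open import Data.List.Relation.Binary.Permutation.Propositional.Properties using (shift; map⁺; ∈-resp-↭)
open import Data.Sum using (_⊎_; inj₁; inj₂; [_,_]) renaming (map to map⊎)
open import Data.Product using (Σ; ∃; _×_; _,_; proj₁; proj₂)
open import Data.Empty using (⊥-elim)
open import Data.Unit using (⊤; tt)
open import Function using (_∘_)
open import Function.Bundles using (Inverse; Injection; Equivalence)
open import Function.Definitions using (Injective)
open import Function.Properties.Inverse using (↔⇒↣; ↔-sym)
open import Relation.Nullary using (¬_; yes; no)
open import Relation.Binary using (tri<; tri≈; tri>)
open import Relation.Binary.PropositionalEquality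
  using (_≡_; _≢_; refl; sym; trans; cong; cong₂; subst; module ≡-Reasoning)

∧-true : ∀ {a b} → a ≡ true → b ≡ true → a ∧ b ≡ true
∧-true refl refl = refl

∧-trueˡ : ∀ {a b} → a ∧ b ≡ true → a ≡ true
∧-trueˡ {true} _ = refl

∧-trueʳ : ∀ {a b} → a ∧ b ≡ true → b ≡ true
∧-trueʳ {true} p = p

∨-trueˡ : ∀ {a b} → a ≡ true → a ∨ b ≡ true
∨-trueˡ refl = refl

∨-trueʳ : ∀ {a b} → b ≡ true → a ∨ b ≡ true
∨-trueʳ {true} _ = refl
∨-trueʳ {false} p = p

∨-true⁻ : ∀ {a b} → a ∨ b ≡ true → a ≡ true ⊎ b ≡ true
∨-true⁻ {true} _ = inj₁ refl
∨-true⁻ {false} p = inj₂ p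

eqF-≢ : ∀ {n} {a b : Fin n} → a ≢ b → eqF a b ≡ false
eqF-≢ {a = a} {b} a≢b with a ≟ b
... | yes a≡b = ⊥-elim (a≢b a≡b)
... | no _ = refl

eqF-≡ : ∀ {n} {a b : Fin n} → eqF a b ≡ true → a ≡ b
eqF-≡ {a = a} {b} _ with a ≟ b
eqF-≡ _ | yes a≡b = a≡b

eqF-injective : ∀ {n n′} {f : Fin n → Fin n′} → Injective _≡_ _≡_ f → ∀ a b → eqF (f a) (f b) ≡ eqF a b
eqF-injective {f = f} f-inj a b with a ≟ b
... | yes refl = eqF-refl (f a)
... | no a≢b = eqF-≢ (a≢b ∘ f-inj)

module _ {n} (G : Graph n) where

  adjacent⇒≢ : ∀ {a b} → E G a b ≡ true → a ≢ b
  adjacent⇒≢ {a} ab refl with trans (sym ab) (E-irr G a)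
  ... | ()

  adjacent-sym : ∀ {a b} → E G a b ≡ true → E G b a ≡ true
  adjacent-sym {a} {b} ab = trans (E-sym G b a) ab

mkGraph-edge⁺ : ∀ {n} (R : Fin n → Fin n → Bool) {a b} →
                (R a b ∨ R b a) ≡ true → a ≢ b → E (mkGraph R) a b ≡ true
mkGraph-edge⁺ R {a} {b} r a≢b rewrite r | eqF-≢ a≢b = refl

mkGraph-edge⁻ : ∀ {n} (R : Fin n → Fin n → Bool) {a b} →
                E (mkGraph R) a b ≡ true → R a b ≡ true ⊎ R b a ≡ true
mkGraph-edge⁻ R ab = ∨-true⁻ (∧-trueˡ ab)

infix 4 _∈ᵗ_ _∉ᵗ_ _⊈ᵗ_ _≉ᵗ_

record Triangle {n} (G : Graph n) : Set where
  constructor triangle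
  field
    {a b c} : Fin n
    ab : E G a b ≡ true
    bc : E G b c ≡ true
    ac : E G a c ≡ true
open Triangle

_∈ᵗ_ : ∀ {n} {G : Graph n} → Fin n → Triangle G → Set
v ∈ᵗ t = v ≡ a t ⊎ v ≡ b t ⊎ v ≡ c t

_∉ᵗ_ : ∀ {n} {G : Graph n} → Fin n → Triangle G → Set
v ∉ᵗ t = ¬ v ∈ᵗ t

_⊈ᵗ_ : ∀ {n} {G : Graph n} → Triangle G → Triangle G → Set
t ⊈ᵗ t′ = ∃ λ v → v ∈ᵗ t × v ∉ᵗ t′

_≉ᵗ_ : ∀ {n} {G : Graph n} → Triangle G → Triangle G → Set
t ≉ᵗ t′ = t ⊈ᵗ t′ ⊎ t′ ⊈ᵗ t

AvoidsEdge : ∀ {n} {G : Graph n} → Fin n → Fin n → Triangle G → Set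
AvoidsEdge x y t = ¬ (x ∈ᵗ t × y ∈ᵗ t)

a∈ᵗ : ∀ {n} {G : Graph n} (t : Triangle G) → a t ∈ᵗ t
a∈ᵗ t = inj₁ refl

b∈ᵗ : ∀ {n} {G : Graph n} (t : Triangle G) → b t ∈ᵗ t
b∈ᵗ t = inj₂ (inj₁ refl)

c∈ᵗ : ∀ {n} {G : Graph n} (t : Triangle G) → c t ∈ᵗ t
c∈ᵗ t = inj₂ (inj₂ refl)

∈ᵗ-adjacent : ∀ {n} {G : Graph n} (t : Triangle G) {u v} → u ∈ᵗ t → v ∈ᵗ t → u ≢ v → E G u v ≡ true
∈ᵗ-adjacent t (inj₁ refl) (inj₂ (inj₁ refl)) _ = ab t
∈ᵗ-adjacent t (inj₁ refl) (inj₂ (inj₂ refl)) _ = ac t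
∈ᵗ-adjacent {G = G} t (inj₂ (inj₂ refl)) (inj₂ (inj₁ refl)) _ = adjacent-sym G (bc t)
∈ᵗ-adjacent t (inj₂ (inj₁ refl)) (inj₂ (inj₂ refl)) _ = bc t
∈ᵗ-adjacent {G = G} t (inj₂ (inj₁ refl)) (inj₁ refl) _ = adjacent-sym G (ab t)
∈ᵗ-adjacent {G = G} t (inj₂ (inj₂ refl)) (inj₁ refl) _ = adjacent-sym G (ac t)
∈ᵗ-adjacent t (inj₁ refl) (inj₁ refl) u≢v = ⊥-elim (u≢v refl)
∈ᵗ-adjacent t (inj₂ (inj₁ refl)) (inj₂ (inj₁ refl)) u≢v = ⊥-elim (u≢v refl)
∈ᵗ-adjacent t (inj₂ (inj₂ refl)) (inj₂ (inj₂ refl)) u≢v = ⊥-elim (u≢v refl)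

record TrianglePair {n} (G : Graph n) (P : Triangle G → Set) : Set where
  constructor pair
  field
    first second : Triangle G
    first-P  : P first
    second-P : P second
    distinct : first ≉ᵗ second

weakenPair : ∀ {n} {G : Graph n} {P P′ : Triangle G → Set} →
             (∀ {t} → P t → P′ t) → TrianglePair G P → TrianglePair G P′
weakenPair P⇒P′ (pair t t′ pt pt′ t≉t′) = pair t t′ (P⇒P′ pt) (P⇒P′ pt′) t≉t′

TwoTriangles : ∀ {n} → Graph n → Set
TwoTriangles G = TrianglePair G (λ _ → ⊤)

module _ {n n′} {G : Graph n} (H : Graph n′) (f : Fin n → Fin n′) where

  Homomorphism : Set
  Homomorphism = ∀ {u v} → E G u v ≡ true → E H (f u) (f v) ≡ true

  PreservesEdgesOf : Triangle G → Set
  PreservesEdgesOf t = ∀ {u v} → u ∈ᵗ t → v ∈ᵗ t → E G u v ≡ true → E H (f u) (f v) ≡ true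

  mapᵗ : (t : Triangle G) → PreservesEdgesOf t → Triangle H
  mapᵗ t p = triangle (p (a∈ᵗ t) (b∈ᵗ t) (ab t)) (p (b∈ᵗ t) (c∈ᵗ t) (bc t)) (p (a∈ᵗ t) (c∈ᵗ t) (ac t))

  module _ (t : Triangle G) (p : PreservesEdgesOf t) where

    ∈-mapᵗ⁺ : ∀ {u} → u ∈ᵗ t → f u ∈ᵗ mapᵗ t p
    ∈-mapᵗ⁺ (inj₁ refl) = inj₁ refl
    ∈-mapᵗ⁺ (inj₂ (inj₁ refl)) = inj₂ (inj₁ refl)
    ∈-mapᵗ⁺ (inj₂ (inj₂ refl)) = inj₂ (inj₂ refl)

    ∈-mapᵗ⁻ : ∀ {w} → w ∈ᵗ mapᵗ t p → ∃ λ u → u ∈ᵗ t × f u ≡ w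
    ∈-mapᵗ⁻ (inj₁ refl) = _ , a∈ᵗ t , refl
    ∈-mapᵗ⁻ (inj₂ (inj₁ refl)) = _ , b∈ᵗ t , refl
    ∈-mapᵗ⁻ (inj₂ (inj₂ refl)) = _ , c∈ᵗ t , refl

  module _ (f-inj : Injective _≡_ _≡_ f) where

    mapᵗ-⊈ : ∀ {t t′} (p : PreservesEdgesOf t) (p′ : PreservesEdgesOf t′) →
             t ⊈ᵗ t′ → mapᵗ t p ⊈ᵗ mapᵗ t′ p′
    mapᵗ-⊈ {t} {t′} p p′ (v , v∈t , v∉t′) = f v , ∈-mapᵗ⁺ t p v∈t , fv∉
      where
      fv∉ : f v ∉ᵗ mapᵗ t′ p′
      fv∉ fv∈ with ∈-mapᵗ⁻ t′ p′ fv∈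
      ... | u , u∈t′ , fu≡fv = v∉t′ (subst (_∈ᵗ t′) (f-inj fu≡fv) u∈t′)

    mapᵗ-≉ : ∀ {t t′} (p : PreservesEdgesOf t) (p′ : PreservesEdgesOf t′) →
             t ≉ᵗ t′ → mapᵗ t p ≉ᵗ mapᵗ t′ p′
    mapᵗ-≉ {t} {t′} p p′ = map⊎ (mapᵗ-⊈ {t} {t′} p p′) (mapᵗ-⊈ {t′} {t} p′ p)

    mapPair : ∀ {P : Triangle G → Set} {P′ : Triangle H → Set} →
              (pres : ∀ t → P t → PreservesEdgesOf t) →
              (∀ t (pt : P t) → P′ (mapᵗ t (pres t pt))) →
              TrianglePair G P → TrianglePair H P′
    mapPair pres P⇒P′ (pair t t′ pt pt′ t≉t′) =
      pair _ _ (P⇒P′ t pt) (P⇒P′ t′ pt′) (mapᵗ-≉ {t} {t′} (pres t pt) (pres t′ pt′) t≉t′)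

  hom-preserves : Homomorphism → ∀ t → PreservesEdgesOf t
  hom-preserves hom t _ _ = hom

-- Counting triangles

length≤sum : ∀ {A : Set} (f : A → ℕ) {L xs : List A} →
             Unique L → All (_∈ xs) L → All (λ a → 1 ≤ f a) L → length L ≤ sum (map f xs)
length≤sum f {[]} _ _ _ = z≤n
length≤sum f {a ∷ L} (a∉L ∷ L-unique) (a∈xs ∷ L⊆xs) (1≤fa ∷ 1≤fL) with ∈-∃++ a∈xs
... | ys , zs , refl = begin
  1 + length L                    ≤⟨ +-mono-≤ 1≤fa (length≤sum f L-unique (All.zipWith drop-a (a∉L , L⊆xs)) 1≤fL) ⟩
  f a + sum (map f (ys ++ zs))    ≡⟨ sum-↭ (map⁺ f (↭-sym (shift a ys zs))) ⟩
  sum (map f (ys ++ a ∷ zs))      ∎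
  where
  open ≤-Reasoning
  drop-a : ∀ {b} → a ≢ b × b ∈ ys ++ a ∷ zs → b ∈ ys ++ zs
  drop-a (a≢b , b∈) with ∈-resp-↭ (shift a ys zs) b∈
  ... | here refl = ⊥-elim (a≢b refl)
  ... | there b∈′ = b∈′

sum-concatMap : ∀ {A B : Set} (g : B → ℕ) (h : A → List B) (xs : List A) →
                sum (map g (concatMap h xs)) ≡ sum (map (λ a → sum (map g (h a))) xs)
sum-concatMap g h [] = refl
sum-concatMap g h (x ∷ xs) = begin
  sum (map g (h x ++ concatMap h xs))              ≡⟨ cong sum (map-++ g (h x) _) ⟩
  sum (map g (h x) ++ map g (concatMap h xs))      ≡⟨ sum-++ (map g (h x)) _ ⟩
  sum (map g (h x)) + sum (map g (concatMap h xs)) ≡⟨ cong (sum (map g (h x)) +_) (sum-concatMap g h xs) ⟩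
  sum (map g (h x)) + sum (map (λ a → sum (map g (h a))) xs) ∎
  where open ≡-Reasoning

Triple : ℕ → Set
Triple n = Fin n × Fin n × Fin n

triples : ∀ n → List (Triple n)
triples n = concatMap (λ i → concatMap (λ j → map (λ k → i , j , k) (allFinL n)) (allFinL n)) (allFinL n)

∈-triples : ∀ {n} (s : Triple n) → s ∈ triples n
∈-triples (i , j , k) =
  ∈-concatMap⁺ _ (lose (∈-allFin i) (∈-concatMap⁺ _ (lose (∈-allFin j) (∈-map⁺ _ (∈-allFin k)))))

countTriple : ∀ {n} → Graph n → Triple n → ℕ
countTriple G (i , j , k) =
  if (toℕ i <ᵇ toℕ j) ∧ (toℕ j <ᵇ toℕ k) ∧ E G i j ∧ E G j k ∧ E G i k then 1 else 0

triangles≡sum-triples : ∀ {n} (G : Graph n) → triangles G ≡ sum (map (countTriple G) (triples n))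
triangles≡sum-triples {n} G = sym (trans (sum-concatMap (countTriple G) _ (allFinL n))
  (cong sum (map-cong (λ i → trans (sum-concatMap (countTriple G) _ (allFinL n))
     (cong sum (map-cong (λ j → cong sum (sym (map-∘ (allFinL n)))) (allFinL n)))) (allFinL n))))

triangles-cong : ∀ {n} (G H : Graph n) → (∀ i j → E G i j ≡ E H i j) → triangles G ≡ triangles H
triangles-cong {n} G H G≗H = begin
  triangles G                               ≡⟨ triangles≡sum-triples G ⟩
  sum (map (countTriple G) (triples n))     ≡⟨ cong sum (map-cong same-count (triples n)) ⟩
  sum (map (countTriple H) (triples n))     ≡⟨ triangles≡sum-triples H ⟨
  triangles H                               ∎
  where
  open ≡-Reasoning
  same-count : ∀ s → countTriple G s ≡ countTriple H s
  same-count (i , j , k) rewrite G≗H i j | G≗H j k | G≗H i k = refl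

_∈³_ : ∀ {n} → Fin n → Triple n → Set
v ∈³ (p , q , r) = v ≡ p ⊎ v ≡ q ⊎ v ≡ r

swap₁₂ : ∀ {A : Set} {x p q r : A} → x ≡ p ⊎ x ≡ q ⊎ x ≡ r → x ≡ q ⊎ x ≡ p ⊎ x ≡ r
swap₁₂ (inj₁ e) = inj₂ (inj₁ e)
swap₁₂ (inj₂ (inj₁ e)) = inj₁ e
swap₁₂ (inj₂ (inj₂ e)) = inj₂ (inj₂ e)

swap₂₃ : ∀ {A : Set} {x p q r : A} → x ≡ p ⊎ x ≡ q ⊎ x ≡ r → x ≡ p ⊎ x ≡ r ⊎ x ≡ q
swap₂₃ (inj₁ e) = inj₁ e
swap₂₃ (inj₂ (inj₁ e)) = inj₂ (inj₂ e)
swap₂₃ (inj₂ (inj₂ e)) = inj₂ (inj₁ e)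

-- `triangles` counts each triangle once, as its vertex triple in increasing order
record SortedTriple {n} {G : Graph n} (t : Triangle G) : Set where
  field
    triple    : Triple n
    counted   : countTriple G triple ≡ 1
    ∈⇒∈³      : ∀ {v} → v ∈ᵗ t → v ∈³ triple
    ∈³⇒∈      : ∀ {v} → v ∈³ triple → v ∈ᵗ t
open SortedTriple

module _ {n} {G : Graph n} where

  sortedTriple : (t : Triangle G) {p q r : Fin n} → toℕ p < toℕ q → toℕ q < toℕ r →
                 E G p q ≡ true → E G q r ≡ true → E G p r ≡ true →
                 (∀ {v} → v ∈ᵗ t → v ∈³ (p , q , r)) → (∀ {v} → v ∈³ (p , q , r) → v ∈ᵗ t) → SortedTriple t
  sortedTriple t {p} {q} {r} p<q q<r pq qr pr fwd bwd = record
    { triple = p , q , r ; counted = counted′ ; ∈⇒∈³ = fwd ; ∈³⇒∈ = bwd }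
    where
    counted′ : countTriple G (p , q , r) ≡ 1
    counted′ rewrite Equivalence.to T-≡ (<⇒<ᵇ p<q) | Equivalence.to T-≡ (<⇒<ᵇ q<r) | pq | qr | pr = refl

  toℕ-≢ : ∀ {u v} → E G u v ≡ true → toℕ u ≢ toℕ v
  toℕ-≢ uv = adjacent⇒≢ G uv ∘ toℕ-injective

  sort : (t : Triangle G) → SortedTriple t
  sort t@(triangle {a} {b} {c} ab bc ac)
    with <-cmp (toℕ a) (toℕ b) | <-cmp (toℕ b) (toℕ c) | <-cmp (toℕ a) (toℕ c)
  ... | tri≈ _ a≡b _ | _ | _ = ⊥-elim (toℕ-≢ ab a≡b)
  ... | _ | tri≈ _ b≡c _ | _ = ⊥-elim (toℕ-≢ bc b≡c)
  ... | _ | _ | tri≈ _ a≡c _ = ⊥-elim (toℕ-≢ ac a≡c)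
  ... | tri< a<b _ _ | tri< b<c _ _ | _ = sortedTriple t a<b b<c ab bc ac (λ m → m) (λ m → m)
  ... | tri< _ _ _ | tri> _ _ c<b | tri< a<c _ _ =
    sortedTriple t a<c c<b ac (adjacent-sym G bc) ab swap₂₃ swap₂₃
  ... | tri< a<b _ _ | tri> _ _ _ | tri> _ _ c<a =
    sortedTriple t c<a a<b (adjacent-sym G ac) ab (adjacent-sym G bc) (swap₁₂ ∘ swap₂₃) (swap₂₃ ∘ swap₁₂)
  ... | tri> _ _ b<a | tri< _ _ _ | tri< a<c _ _ =
    sortedTriple t b<a a<c (adjacent-sym G ab) ac bc swap₁₂ swap₁₂
  ... | tri> _ _ _ | tri< b<c _ _ | tri> _ _ c<a =
    sortedTriple t b<c c<a bc (adjacent-sym G ac) (adjacent-sym G ab) (swap₂₃ ∘ swap₁₂) (swap₁₂ ∘ swap₂₃)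
  ... | tri> _ _ b<a | tri> _ _ c<b | _ =
    sortedTriple t c<b b<a (adjacent-sym G bc) (adjacent-sym G ab) (adjacent-sym G ac)
      (swap₁₂ ∘ swap₂₃ ∘ swap₁₂) (swap₁₂ ∘ swap₂₃ ∘ swap₁₂)

  sort-≉ : ∀ {t t′ : Triangle G} → t ≉ᵗ t′ → triple (sort t) ≢ triple (sort t′)
  sort-≉ {t} {t′} (inj₁ (v , v∈t , v∉t′)) eq =
    v∉t′ (∈³⇒∈ (sort t′) (subst (v ∈³_) eq (∈⇒∈³ (sort t) v∈t)))
  sort-≉ {t} {t′} (inj₂ (v , v∈t′ , v∉t)) eq =
    v∉t (∈³⇒∈ (sort t) (subst (v ∈³_) (sym eq) (∈⇒∈³ (sort t′) v∈t′)))

  distinct-length≤triangles : ∀ {ts : List (Triangle G)} → AllPairs _≉ᵗ_ ts → length ts ≤ triangles G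
  distinct-length≤triangles {ts} distinct = begin
    length ts                                        ≡⟨ length-map key ts ⟨
    length (map key ts)                              ≤⟨ length≤sum (countTriple G) keys-unique
                                                          (All.universal ∈-triples _) keys-counted ⟩
    sum (map (countTriple G) (triples n))            ≡⟨ triangles≡sum-triples G ⟨
    triangles G                                      ∎
    where
    open ≤-Reasoning
    key : Triangle G → Triple n
    key t = triple (sort t)
    keys-unique : Unique (map key ts)
    keys-unique = AllPairs.map⁺ {f = key} (AllPairs.map sort-≉ distinct)
    keys-counted : All (λ s → 1 ≤ countTriple G s) (map key ts)
    keys-counted = All.map⁺ (All.universal (λ t → ≤-reflexive (sym (counted (sort t)))) ts)

  pair⇒2≤triangles : ∀ {P} → TrianglePair G P → 2 ≤ triangles G
  pair⇒2≤triangles (pair t t′ _ _ t≉t′) = distinct-length≤triangles {t ∷ t′ ∷ []} ((t≉t′ ∷ []) ∷ [] ∷ [])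

-- Deleting a vertex

module Deletion {m} (G : Graph (suc m)) (z : Fin (suc m)) where

  private
    R : Fin m → Fin m → Bool
    R i j = E G (punchIn z i) (punchIn z j)

  punchIn-hom : Homomorphism {G = delete G z} G (punchIn z)
  punchIn-hom ij with mkGraph-edge⁻ R ij
  ... | inj₁ e = e
  ... | inj₂ e = adjacent-sym G e

  punchOut-edge : ∀ {u v} (z≢u : z ≢ u) (z≢v : z ≢ v) → E G u v ≡ true →
                  E (delete G z) (punchOut z≢u) (punchOut z≢v) ≡ true
  punchOut-edge {u} {v} z≢u z≢v uv = mkGraph-edge⁺ R edge (adjacent⇒≢ G uv ∘ punched-equal)
    where
    edge : (R (punchOut z≢u) (punchOut z≢v) ∨ R (punchOut z≢v) (punchOut z≢u)) ≡ true
    edge rewrite punchIn-punchOut z≢u | punchIn-punchOut z≢v = ∨-trueˡ uv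
    punched-equal : punchOut z≢u ≡ punchOut z≢v → u ≡ v
    punched-equal eq = trans (sym (punchIn-punchOut z≢u)) (trans (cong (punchIn z) eq) (punchIn-punchOut z≢v))

  module _ (t : Triangle G) (z∉t : z ∉ᵗ t) where

    ∉ᵗ⇒≢ : ∀ {v} → v ∈ᵗ t → z ≢ v
    ∉ᵗ⇒≢ v∈t refl = z∉t v∈t

    restrict : Triangle (delete G z)
    restrict = triangle (punchOut-edge (∉ᵗ⇒≢ (a∈ᵗ t)) (∉ᵗ⇒≢ (b∈ᵗ t)) (ab t))
                        (punchOut-edge (∉ᵗ⇒≢ (b∈ᵗ t)) (∉ᵗ⇒≢ (c∈ᵗ t)) (bc t))
                        (punchOut-edge (∉ᵗ⇒≢ (a∈ᵗ t)) (∉ᵗ⇒≢ (c∈ᵗ t)) (ac t))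

    ∈-restrict⁻ : ∀ {i} → i ∈ᵗ restrict → punchIn z i ∈ᵗ t
    ∈-restrict⁻ (inj₁ refl) = inj₁ (punchIn-punchOut _)
    ∈-restrict⁻ (inj₂ (inj₁ refl)) = inj₂ (inj₁ (punchIn-punchOut _))
    ∈-restrict⁻ (inj₂ (inj₂ refl)) = inj₂ (inj₂ (punchIn-punchOut _))

    ∈-restrict⁺ : ∀ {v} → v ∈ᵗ t → ∃ λ i → i ∈ᵗ restrict × punchIn z i ≡ v
    ∈-restrict⁺ (inj₁ refl) = _ , inj₁ refl , punchIn-punchOut _
    ∈-restrict⁺ (inj₂ (inj₁ refl)) = _ , inj₂ (inj₁ refl) , punchIn-punchOut _
    ∈-restrict⁺ (inj₂ (inj₂ refl)) = _ , inj₂ (inj₂ refl) , punchIn-punchOut _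

  restrict-⊈ : ∀ t t′ (z∉t : z ∉ᵗ t) (z∉t′ : z ∉ᵗ t′) → t ⊈ᵗ t′ → restrict t z∉t ⊈ᵗ restrict t′ z∉t′
  restrict-⊈ t t′ z∉t z∉t′ (v , v∈t , v∉t′) with ∈-restrict⁺ t z∉t v∈t
  ... | i , i∈ , refl = i , i∈ , v∉t′ ∘ ∈-restrict⁻ t′ z∉t′

  restrictPair : TrianglePair G (z ∉ᵗ_) → TwoTriangles (delete G z)
  restrictPair (pair t t′ z∉t z∉t′ t≉t′) = pair (restrict t z∉t) (restrict t′ z∉t′) tt tt
    (map⊎ (restrict-⊈ t t′ z∉t z∉t′) (restrict-⊈ t′ t z∉t′ z∉t) t≉t′)

-- Splitting a vertex

bool-pigeonhole : ∀ (p q r : Bool) → p ≡ q ⊎ p ≡ r ⊎ q ≡ r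
bool-pigeonhole false false _ = inj₁ refl
bool-pigeonhole true true _ = inj₁ refl
bool-pigeonhole false true false = inj₂ (inj₁ refl)
bool-pigeonhole true false true = inj₂ (inj₁ refl)
bool-pigeonhole false true true = inj₂ (inj₂ refl)
bool-pigeonhole true false false = inj₂ (inj₂ refl)

module Splitting {m} (G : Graph (suc m)) (z : Fin (suc m)) (side : Fin (suc m) → Bool) where

  open Deletion G z

  S : Graph (suc (suc m))
  S = split G z side

  old : Fin m → Fin (suc (suc m))
  old i = suc (suc i)

  old-injective : Injective _≡_ _≡_ old
  old-injective refl = refl

  old-hom : Homomorphism {G = delete G z} S old
  old-hom ij = ∧-true (∨-trueˡ (punchIn-hom ij)) (cong not (eqF-≢ (adjacent⇒≢ (delete G z) ij ∘ old-injective)))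

  copy : Bool → Fin (suc (suc m))
  copy true = zero
  copy false = suc zero

  copy≢old : ∀ s i → old i ≢ copy s
  copy≢old true i ()
  copy≢old false i ()

  copy-edge : ∀ {v} (z≢v : z ≢ v) → E G z v ≡ true → E S (copy (side v)) (old (punchOut z≢v)) ≡ true
  copy-edge {v} z≢v zv = subst (λ w → E S (copy (side w)) (old i) ≡ true) (punchIn-punchOut z≢v) (edge zi)
    where
    i = punchOut z≢v
    zi : E G z (punchIn z i) ≡ true
    zi = subst (λ w → E G z w ≡ true) (sym (punchIn-punchOut z≢v)) zv
    edge : E G z (punchIn z i) ≡ true → E S (copy (side (punchIn z i))) (old i) ≡ true
    edge zi with side (punchIn z i) in s
    ... | true = ∧-true (∨-trueˡ (∧-true zi s)) refl
    ... | false = ∧-true (∨-trueˡ (∧-true zi (cong not s))) refl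

  old-preserves : ∀ (t : Triangle (delete G z)) → PreservesEdgesOf S old t
  old-preserves = hom-preserves S old old-hom

  lift : (t : Triangle G) → z ∉ᵗ t → Triangle S
  lift t z∉t = mapᵗ S old (restrict t z∉t) (old-preserves (restrict t z∉t))

  copy∉lift : ∀ s (t : Triangle G) (z∉t : z ∉ᵗ t) → copy s ∉ᵗ lift t z∉t
  copy∉lift s t z∉t copy∈ with ∈-mapᵗ⁻ S old (restrict t z∉t) (old-preserves (restrict t z∉t)) copy∈
  ... | i , _ , eq = copy≢old s i eq

  splitPair-avoiding : TrianglePair G (z ∉ᵗ_) → TwoTriangles S
  splitPair-avoiding p = mapPair S old old-injective (λ t _ → old-preserves t) (λ _ _ → tt) (restrictPair p)

  module _ (t : Triangle G) (z∉t : z ∉ᵗ t) (z-adj : ∀ {v} → v ∈ᵗ t → E G z v ≡ true) where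

    pairWithCopy : ∀ {u v} → u ∈ᵗ t → v ∈ᵗ t → u ≢ v → side u ≡ side v → TwoTriangles S
    pairWithCopy {u} {v} u∈t v∈t u≢v same-side = pair (lift t z∉t) copy-triangle tt tt
      (inj₂ (copy (side u) , inj₁ refl , copy∉lift (side u) t z∉t))
      where
      z≢u = ∉ᵗ⇒≢ t z∉t u∈t
      z≢v = ∉ᵗ⇒≢ t z∉t v∈t
      copy-triangle : Triangle S
      copy-triangle = triangle {a = copy (side u)}
        (copy-edge z≢u (z-adj u∈t))
        (old-hom (punchOut-edge z≢u z≢v (∈ᵗ-adjacent t u∈t v∈t u≢v)))
        (subst (λ s → E S (copy s) (old (punchOut z≢v)) ≡ true) (sym same-side) (copy-edge z≢v (z-adj v∈t)))

    splitPair-neighbourhood : TwoTriangles S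
    splitPair-neighbourhood with bool-pigeonhole (side (a t)) (side (b t)) (side (c t))
    ... | inj₁ eq = pairWithCopy (a∈ᵗ t) (b∈ᵗ t) (adjacent⇒≢ G (ab t)) eq
    ... | inj₂ (inj₁ eq) = pairWithCopy (a∈ᵗ t) (c∈ᵗ t) (adjacent⇒≢ G (ac t)) eq
    ... | inj₂ (inj₂ eq) = pairWithCopy (b∈ᵗ t) (c∈ᵗ t) (adjacent⇒≢ G (bc t)) eq

-- Complete graphs

Complete : ∀ {n} → Graph n → Set
Complete G = ∀ a b → E G a b ≡ not (eqF a b)

K4-complete : Complete K4
K4-complete a b = refl

≅-complete : ∀ {n n′} {G : Graph n} {H : Graph n′} → G ≅ H → Complete H → Complete G
≅-complete {G = G} {H} iso H-complete a b = begin
  E G a b                 ≡⟨ _≅_.preserve iso a b ⟨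
  E H (to a) (to b)       ≡⟨ H-complete (to a) (to b) ⟩
  not (eqF (to a) (to b)) ≡⟨ cong not (eqF-injective (Injection.injective (↔⇒↣ (_≅_.bij iso))) a b) ⟩
  not (eqF a b)           ∎
  where
  open ≡-Reasoning
  to = Inverse.to (_≅_.bij iso)

complete-adjacent : ∀ {n} {G : Graph n} → Complete G → ∀ {a b} → a ≢ b → E G a b ≡ true
complete-adjacent complete a≢b = trans (complete _ _) (cong not (eqF-≢ a≢b))

delete-complete : ∀ {m} {G : Graph (suc m)} → Complete G → ∀ z → Complete (delete G z)
delete-complete {G = G} complete z i j
  rewrite complete (punchIn z i) (punchIn z j) | complete (punchIn z j) (punchIn z i)
        | eqF-injective (punchIn-injective z _ _) i j | eqF-injective (punchIn-injective z _ _) j i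
        | eqF-sym j i = trans (cong (_∧ not (eqF i j)) (∨-idem (not (eqF i j)))) (∧-idem (not (eqF i j)))

complete-triangles : ∀ {n} {G H : Graph n} → Complete G → Complete H → triangles G ≡ triangles H
complete-triangles {G = G} {H} G-complete H-complete =
  triangles-cong G H (λ i j → trans (G-complete i j) (sym (H-complete i j)))

module CompleteGraph4 (G : Graph 4) (complete : Complete G) where

  face : Fin 4 → Triangle G
  face z = triangle (edge zero (suc zero) (λ ())) (edge (suc zero) (suc (suc zero)) (λ ()))
                    (edge zero (suc (suc zero)) (λ ()))
    where
    edge : ∀ (i j : Fin 3) → i ≢ j → E G (punchIn z i) (punchIn z j) ≡ true
    edge i j i≢j = complete-adjacent {G = G} complete (i≢j ∘ punchIn-injective z i j)

  ∉face : ∀ z → z ∉ᵗ face z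
  ∉face z (inj₁ eq) = punchInᵢ≢i z zero (sym eq)
  ∉face z (inj₂ (inj₁ eq)) = punchInᵢ≢i z (suc zero) (sym eq)
  ∉face z (inj₂ (inj₂ eq)) = punchInᵢ≢i z (suc (suc zero)) (sym eq)

  ∈face : ∀ {z w} → z ≢ w → w ∈ᵗ face z
  ∈face z≢w with punchOut z≢w | punchIn-punchOut z≢w
  ... | zero | eq = inj₁ (sym eq)
  ... | suc zero | eq = inj₂ (inj₁ (sym eq))
  ... | suc (suc zero) | eq = inj₂ (inj₂ (sym eq))

  face-adjacent : ∀ z {v} → v ∈ᵗ face z → E G z v ≡ true
  face-adjacent z v∈ = complete-adjacent {G = G} complete λ { refl → ∉face z v∈ }

  face-≉ : ∀ x y → x ≢ y → face x ≉ᵗ face y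
  face-≉ x y x≢y = inj₁ (y , ∈face x≢y , ∉face y)

  faces-distinct : AllPairs _≉ᵗ_ (map face (allFinL 4))
  faces-distinct = (face-≉ (# 0) (# 1) (λ ()) ∷ face-≉ (# 0) (# 2) (λ ()) ∷ face-≉ (# 0) (# 3) (λ ()) ∷ [])
                 ∷ (face-≉ (# 1) (# 2) (λ ()) ∷ face-≉ (# 1) (# 3) (λ ()) ∷ [])
                 ∷ (face-≉ (# 2) (# 3) (λ ()) ∷ [])
                 ∷ [] ∷ []

  facePair-avoidingEdge : ∀ {x y} → E G x y ≡ true → TrianglePair G (AvoidsEdge x y)
  facePair-avoidingEdge {x} {y} xy =
    pair (face x) (face y) (∉face x ∘ proj₁) (∉face y ∘ proj₂) (face-≉ x y (adjacent⇒≢ G xy))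

  triangles-delete : ∀ z → triangles (delete G z) ≡ 1
  -- triangles (delete K4 zero) computes to 1
  triangles-delete z = complete-triangles {G = delete G z} {H = delete K4 zero}
    (delete-complete {G = G} complete z) (delete-complete {G = K4} K4-complete zero)

record DistinctTriangles {n} (G : Graph n) (k : ℕ) : Set where
  constructor distinctTriangles
  field
    list     : List (Triangle G)
    length≡k : length list ≡ k
    pairwise : AllPairs _≉ᵗ_ list

EdgeAvoiding : ∀ {n} → Graph n → Set
EdgeAvoiding G = ∀ {x y} → E G x y ≡ true → TrianglePair G (AvoidsEdge x y)

VertexAvoiding : ∀ {n} → Graph n → Set
VertexAvoiding G = ∀ z → TrianglePair G (z ∉ᵗ_)

record TriangleRich {n} (G : Graph n) : Set where
  field
    four       : DistinctTriangles G 4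
    edgePairs  : EdgeAvoiding G
    vertexPairs : G ≅ K4 ⊎ VertexAvoiding G

distinct⇒k≤triangles : ∀ {n k} {G : Graph n} → DistinctTriangles G k → k ≤ triangles G
distinct⇒k≤triangles (distinctTriangles ts refl ts-distinct) = distinct-length≤triangles ts-distinct

≅K4⇒Complete : ∀ {n} {G : Graph n} → G ≅ K4 → Complete G
≅K4⇒Complete iso = ≅-complete iso K4-complete

≅K4⇒TriangleRich : ∀ {n} {G : Graph n} → G ≅ K4 → TriangleRich G
≅K4⇒TriangleRich {G = G} iso with ↔⇒≡ (_≅_.bij iso)
... | refl = record
  { four        = distinctTriangles (map face (allFinL 4)) refl faces-distinct
  ; edgePairs   = facePair-avoidingEdge
  ; vertexPairs = inj₁ iso
  }
  where open CompleteGraph4 G (≅K4⇒Complete iso)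

≅K4⇒neighbourhoodTriangle : ∀ {n} {G : Graph n} → G ≅ K4 → ∀ z →
                            Σ (Triangle G) λ t → z ∉ᵗ t × (∀ {v} → v ∈ᵗ t → E G z v ≡ true)
≅K4⇒neighbourhoodTriangle {G = G} iso z with ↔⇒≡ (_≅_.bij iso)
... | refl = face z , ∉face z , face-adjacent z
  where open CompleteGraph4 G (≅K4⇒Complete iso)

≅K4⇒triangles-delete : ∀ {n} {G : Graph n} → G ≅ K4 → ∀ z → triangles (delete G z) ≡ 1
≅K4⇒triangles-delete {G = G} iso z with ↔⇒≡ (_≅_.bij iso)
... | refl = triangles-delete z
  where open CompleteGraph4 G (≅K4⇒Complete iso)

avoidingTriangle : ∀ {n} {G : Graph n} → TriangleRich G → ∀ z → Σ (Triangle G) (z ∉ᵗ_)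
avoidingTriangle rich z with TriangleRich.vertexPairs rich
... | inj₁ iso = let t , z∉t , _ = ≅K4⇒neighbourhoodTriangle iso z in t , z∉t
... | inj₂ pairs = let open TrianglePair (pairs z) in first , first-P

splitPair : ∀ {m} {G : Graph (suc m)} → TriangleRich G → ∀ z side → TwoTriangles (split G z side)
splitPair {G = G} rich z side with TriangleRich.vertexPairs rich
... | inj₁ iso = let t , z∉t , z-adj = ≅K4⇒neighbourhoodTriangle iso z in
                Splitting.splitPair-neighbourhood G z side t z∉t z-adj
... | inj₂ pairs = Splitting.splitPair-avoiding G z side (pairs z)

-- Ore-composition

module OreComposition {n₁ m} (G₁ : Graph n₁) (x y : Fin n₁) (xy : E G₁ x y ≡ true)
                      (G₂ : Graph (suc m)) (z : Fin (suc m)) (side : Fin (suc m) → Bool) where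

  open Deletion G₂ z using (punchIn-hom; restrict)
  open Splitting G₂ z side using (S; old)

  H : Graph (n₁ + m)
  H = oreComp G₁ x y G₂ z side

  ι₁ : Fin n₁ → Fin (n₁ + m)
  ι₁ u = u ↑ˡ m

  ι₂ : Fin m → Fin (n₁ + m)
  ι₂ j = n₁ ↑ʳ j

  ι₁-injective : Injective _≡_ _≡_ ι₁
  ι₁-injective = ↑ˡ-injective m _ _

  ι₂-injective : Injective _≡_ _≡_ ι₂
  ι₂-injective = ↑ʳ-injective n₁ _ _

  ι₁≢ι₂ : ∀ {u j} → ι₁ u ≢ ι₂ j
  ι₁≢ι₂ {u} {j} eq with trans (sym (splitAt-↑ˡ n₁ u m)) (trans (cong (splitAt n₁) eq) (splitAt-↑ʳ n₁ m j))
  ... | ()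

  ι-view : ∀ w → (∃ λ u → ι₁ u ≡ w) ⊎ (∃ λ j → ι₂ j ≡ w)
  ι-view w with splitAt n₁ w | join-splitAt n₁ m w
  ... | inj₁ u | eq = inj₁ (u , eq)
  ... | inj₂ j | eq = inj₂ (j , eq)

  isEdgeXY : Fin n₁ → Fin n₁ → Bool
  isEdgeXY u v = (eqF u x ∧ eqF v y) ∨ (eqF u y ∧ eqF v x)

  ι₁-edge : ∀ {u v} → E G₁ u v ≡ true → isEdgeXY u v ≡ false → E H (ι₁ u) (ι₁ v) ≡ true
  ι₁-edge {u} {v} uv not-xy rewrite splitAt-↑ˡ n₁ u m | splitAt-↑ˡ n₁ v m =
    ∧-true (∨-trueˡ (∧-true uv (cong not not-xy))) (cong not (eqF-≢ (adjacent⇒≢ G₁ uv ∘ ι₁-injective)))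

  ι₂-edge : ∀ {i j} → E G₂ (punchIn z i) (punchIn z j) ≡ true → E H (ι₂ i) (ι₂ j) ≡ true
  ι₂-edge {i} {j} ij rewrite splitAt-↑ʳ n₁ m i | splitAt-↑ʳ n₁ m j =
    ∧-true (∨-trueˡ ij) (cong not (eqF-≢ (adjacent⇒≢ G₂ ij ∘ cong (punchIn z) ∘ ι₂-injective)))

  x-edge : ∀ {j} → E G₂ z (punchIn z j) ∧ side (punchIn z j) ≡ true → E H (ι₁ x) (ι₂ j) ≡ true
  x-edge {j} zj rewrite splitAt-↑ˡ n₁ x m | splitAt-↑ʳ n₁ m j | eqF-refl x =
    ∧-true (∨-trueˡ (∨-trueˡ zj)) (cong not (eqF-≢ ι₁≢ι₂))

  y-edge : ∀ {j} → E G₂ z (punchIn z j) ∧ not (side (punchIn z j)) ≡ true → E H (ι₁ y) (ι₂ j) ≡ true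
  y-edge {j} zj rewrite splitAt-↑ˡ n₁ y m | splitAt-↑ʳ n₁ m j | eqF-refl y =
    ∧-true (∨-trueˡ (∨-trueʳ {eqF y x ∧ E G₂ z (punchIn z j) ∧ side (punchIn z j)} zj)) (cong not (eqF-≢ ι₁≢ι₂))

  -- the copy of the split graph inside H
  ψ : Fin (suc (suc m)) → Fin (n₁ + m)
  ψ zero = ι₁ x
  ψ (suc zero) = ι₁ y
  ψ (suc (suc j)) = ι₂ j

  ψ⁻¹-ι₁ : ∀ {p u} → ψ p ≡ ι₁ u → (p ≡ zero × u ≡ x) ⊎ (p ≡ suc zero × u ≡ y)
  ψ⁻¹-ι₁ {zero} eq = inj₁ (refl , sym (ι₁-injective eq))
  ψ⁻¹-ι₁ {suc zero} eq = inj₂ (refl , sym (ι₁-injective eq))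
  ψ⁻¹-ι₁ {suc (suc j)} eq = ⊥-elim (ι₁≢ι₂ (sym eq))

  ψ-injective : Injective _≡_ _≡_ ψ
  ψ-injective {zero} {q} eq with ψ⁻¹-ι₁ {q} (sym eq)
  ... | inj₁ (refl , _) = refl
  ... | inj₂ (refl , x≡y) = ⊥-elim (adjacent⇒≢ G₁ xy x≡y)
  ψ-injective {suc zero} {q} eq with ψ⁻¹-ι₁ {q} (sym eq)
  ... | inj₁ (refl , y≡x) = ⊥-elim (adjacent⇒≢ G₁ xy (sym y≡x))
  ... | inj₂ (refl , _) = refl
  ψ-injective {suc (suc i)} {zero} eq = ⊥-elim (ι₁≢ι₂ (sym eq))
  ψ-injective {suc (suc i)} {suc zero} eq = ⊥-elim (ι₁≢ι₂ (sym eq))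
  ψ-injective {suc (suc i)} {suc (suc j)} eq = cong (λ k → suc (suc k)) (ι₂-injective eq)

  ψ-hom : Homomorphism {G = S} H ψ
  ψ-hom {zero} {zero} pq = ⊥-elim (adjacent⇒≢ S {zero} pq refl)
  ψ-hom {suc zero} {suc zero} pq = ⊥-elim (adjacent⇒≢ S {suc zero} pq refl)
  ψ-hom {zero} {suc zero} ()
  ψ-hom {suc zero} {zero} ()
  ψ-hom {zero} {suc (suc j)} pq with ∨-true⁻ (∧-trueˡ pq)
  ... | inj₁ e = x-edge e
  ψ-hom {suc zero} {suc (suc j)} pq with ∨-true⁻ (∧-trueˡ pq)
  ... | inj₁ e = y-edge e
  ψ-hom {suc (suc i)} {suc (suc j)} pq with ∨-true⁻ (∧-trueˡ pq)
  ... | inj₁ e = ι₂-edge e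
  ... | inj₂ e = ι₂-edge (adjacent-sym G₂ e)
  ψ-hom {suc (suc i)} {zero} pq =
    adjacent-sym H (ψ-hom {zero} {suc (suc i)} (adjacent-sym S {suc (suc i)} {zero} pq))
  ψ-hom {suc (suc i)} {suc zero} pq =
    adjacent-sym H (ψ-hom {suc zero} {suc (suc i)} (adjacent-sym S {suc (suc i)} {suc zero} pq))

  -- z₁ and z₂ are not adjacent in S, so no triangle of S lies inside {z₁, z₂}
  S-triangle-meets-old : (t : Triangle S) → ∃ λ j → old j ∈ᵗ t
  S-triangle-meets-old (triangle {suc (suc j)} _ _ _) = j , inj₁ refl
  S-triangle-meets-old (triangle {zero} {suc (suc j)} _ _ _) = j , inj₂ (inj₁ refl)
  S-triangle-meets-old (triangle {suc zero} {suc (suc j)} _ _ _) = j , inj₂ (inj₁ refl)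
  S-triangle-meets-old (triangle {zero} {zero} ab _ _) = ⊥-elim (adjacent⇒≢ S {zero} ab refl)
  S-triangle-meets-old (triangle {suc zero} {suc zero} ab _ _) = ⊥-elim (adjacent⇒≢ S {suc zero} ab refl)
  S-triangle-meets-old (triangle {zero} {suc zero} () _ _)
  S-triangle-meets-old (triangle {suc zero} {zero} () _ _)

  InsideG₁ : Triangle H → Set
  InsideG₁ t = ∀ {j} → ι₂ j ∉ᵗ t

  record MeetsG₂ (t : Triangle H) : Set where
    field
      g₂-vertex : ∃ λ j → ι₂ j ∈ᵗ t
      g₁-vertex-end : ∀ {u} → ι₁ u ∈ᵗ t → u ≡ x ⊎ u ≡ y
      g₁-vertex-unique : ∀ {u v} → ι₁ u ∈ᵗ t → ι₁ v ∈ᵗ t → u ≡ v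

  InsideG₁-MeetsG₂-≉ : ∀ t t′ → InsideG₁ t → MeetsG₂ t′ → t ≉ᵗ t′
  InsideG₁-MeetsG₂-≉ t t′ t-inside t′-meets =
    let j , ι₂j∈t′ = MeetsG₂.g₂-vertex t′-meets in inj₂ (ι₂ j , ι₂j∈t′ , t-inside)

  ι₁-preserves : ∀ (t : Triangle G₁) → AvoidsEdge x y t → PreservesEdgesOf H ι₁ t
  ι₁-preserves t avoids {u} {v} u∈t v∈t uv = ι₁-edge uv (¬-not not-xy)
    where
    not-xy : isEdgeXY u v ≢ true
    not-xy is-xy with ∨-true⁻ is-xy
    ... | inj₁ xy-order = avoids (subst (_∈ᵗ t) (eqF-≡ (∧-trueˡ xy-order)) u∈t ,
                                  subst (_∈ᵗ t) (eqF-≡ (∧-trueʳ xy-order)) v∈t)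
    ... | inj₂ yx-order = avoids (subst (_∈ᵗ t) (eqF-≡ (∧-trueʳ yx-order)) v∈t ,
                                  subst (_∈ᵗ t) (eqF-≡ (∧-trueˡ yx-order)) u∈t)

  ι₁-image : (t : Triangle G₁) → AvoidsEdge x y t → Triangle H
  ι₁-image t avoids = mapᵗ H ι₁ t (ι₁-preserves t avoids)

  ι₁-image-inside : ∀ (t : Triangle G₁) avoids → InsideG₁ (ι₁-image t avoids)
  ι₁-image-inside t avoids ι₂j∈ = let _ , _ , eq = ∈-mapᵗ⁻ H ι₁ t (ι₁-preserves t avoids) ι₂j∈ in ι₁≢ι₂ eq

  ι₁-image-∉ : ∀ {u} (t : Triangle G₁) avoids → u ∉ᵗ t → ι₁ u ∉ᵗ ι₁-image t avoids
  ι₁-image-∉ t avoids u∉t ι₁u∈ with ∈-mapᵗ⁻ H ι₁ t (ι₁-preserves t avoids) ι₁u∈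
  ... | _ , v∈t , eq = u∉t (subst (_∈ᵗ t) (ι₁-injective eq) v∈t)

  ψ-preserves : ∀ (t : Triangle S) → PreservesEdgesOf H ψ t
  ψ-preserves t {p} {q} _ _ = ψ-hom {p} {q}

  ψ-image : Triangle S → Triangle H
  ψ-image t = mapᵗ H ψ t (ψ-preserves t)

  ψ-image-meets : ∀ t → MeetsG₂ (ψ-image t)
  ψ-image-meets t = record
    { g₂-vertex = let j , j∈t = S-triangle-meets-old t in j , ∈-mapᵗ⁺ H ψ t pres j∈t
    ; g₁-vertex-end = λ ι₁u∈ → map⊎ proj₂ proj₂ (proj₂ (proj₂ (preimage ι₁u∈)))
    ; g₁-vertex-unique = unique
    }
    where
    pres = ψ-preserves t
    preimage : ∀ {u} → ι₁ u ∈ᵗ ψ-image t → ∃ λ p → p ∈ᵗ t × ((p ≡ zero × u ≡ x) ⊎ (p ≡ suc zero × u ≡ y))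
    preimage ι₁u∈ = let p , p∈t , eq = ∈-mapᵗ⁻ H ψ t pres ι₁u∈ in p , p∈t , ψ⁻¹-ι₁ eq
    unique : ∀ {u v} → ι₁ u ∈ᵗ ψ-image t → ι₁ v ∈ᵗ ψ-image t → u ≡ v
    unique ι₁u∈ ι₁v∈ with preimage ι₁u∈ | preimage ι₁v∈
    ... | _ , _ , inj₁ (_ , refl) | _ , _ , inj₁ (_ , refl) = refl
    ... | _ , _ , inj₂ (_ , refl) | _ , _ , inj₂ (_ , refl) = refl
    ... | _ , p∈t , inj₁ (refl , _) | _ , q∈t , inj₂ (refl , _) with ∈ᵗ-adjacent t p∈t q∈t (λ ())
    ...   | ()
    unique _ _ | _ , p∈t , inj₂ (refl , _) | _ , q∈t , inj₁ (refl , _) with ∈ᵗ-adjacent t p∈t q∈t (λ ())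
    ...   | ()

  ι₂-hom : Homomorphism {G = delete G₂ z} H ι₂
  ι₂-hom = ι₂-edge ∘ punchIn-hom

  ι₂-preserves : ∀ (t : Triangle (delete G₂ z)) → PreservesEdgesOf H ι₂ t
  ι₂-preserves = hom-preserves H ι₂ ι₂-hom

  ι₂-image : (t : Triangle G₂) → z ∉ᵗ t → Triangle H
  ι₂-image t z∉t = mapᵗ H ι₂ (restrict t z∉t) (ι₂-preserves (restrict t z∉t))

  ι₂-image-∉ : ∀ {u} (t : Triangle G₂) z∉t → ι₁ u ∉ᵗ ι₂-image t z∉t
  ι₂-image-∉ t z∉t ι₁u∈ =
    let _ , _ , eq = ∈-mapᵗ⁻ H ι₂ (restrict t z∉t) (ι₂-preserves (restrict t z∉t)) ι₁u∈ in ι₁≢ι₂ (sym eq)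

  module _ (rich₁ : TriangleRich G₁) (rich₂ : TriangleRich G₂) where

    pairA : TrianglePair H InsideG₁
    pairA = mapPair H ι₁ ι₁-injective ι₁-preserves ι₁-image-inside (TriangleRich.edgePairs rich₁ xy)

    pairB : TrianglePair H MeetsG₂
    pairB = mapPair H ψ ψ-injective (λ t _ → ψ-preserves t) (λ t _ → ψ-image-meets t) (splitPair rich₂ z side)

    four : DistinctTriangles H 4
    four = distinctTriangles (A₁ ∷ A₂ ∷ B₁ ∷ B₂ ∷ []) refl
      ( (A₁≉A₂ ∷ InsideG₁-MeetsG₂-≉ A₁ B₁ A₁-in B₁-meets ∷ InsideG₁-MeetsG₂-≉ A₁ B₂ A₁-in B₂-meets ∷ [])
      ∷ (InsideG₁-MeetsG₂-≉ A₂ B₁ A₂-in B₁-meets ∷ InsideG₁-MeetsG₂-≉ A₂ B₂ A₂-in B₂-meets ∷ [])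
      ∷ (B₁≉B₂ ∷ [])
      ∷ [] ∷ [])
      where
      open TrianglePair pairA renaming (first to A₁; second to A₂; first-P to A₁-in; second-P to A₂-in; distinct to A₁≉A₂)
      open TrianglePair pairB renaming (first to B₁; second to B₂; first-P to B₁-meets; second-P to B₂-meets; distinct to B₁≉B₂)

    edgePairs : EdgeAvoiding H
    edgePairs {a} {b} ab with ι-view a | ι-view b
    ... | inj₂ (j , refl) | _ = weakenPair (λ inside (ι₂j∈ , _) → inside ι₂j∈) pairA
    ... | inj₁ _ | inj₂ (j , refl) = weakenPair (λ inside (_ , ι₂j∈) → inside ι₂j∈) pairA
    ... | inj₁ (u , refl) | inj₁ (v , refl) =
      weakenPair (λ meets (ι₁u∈ , ι₁v∈) → adjacent⇒≢ H ab (cong ι₁ (MeetsG₂.g₁-vertex-unique meets ι₁u∈ ι₁v∈))) pairB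

    pairAvoidingEnd : ∀ {w} → (∀ {t : Triangle G₁} → w ∉ᵗ t → AvoidsEdge x y t) → TrianglePair H (ι₁ w ∉ᵗ_)
    pairAvoidingEnd {w} avoids = pair (ι₁-image t₁ t₁-avoids) (ι₂-image t₂ z∉t₂)
      (ι₁-image-∉ t₁ t₁-avoids w∉t₁) (ι₂-image-∉ t₂ z∉t₂)
      (inj₁ (ι₁ (a t₁) , ∈-mapᵗ⁺ H ι₁ t₁ (ι₁-preserves t₁ t₁-avoids) (a∈ᵗ t₁) , ι₂-image-∉ t₂ z∉t₂))
      where
      t₁ = proj₁ (avoidingTriangle rich₁ w)
      w∉t₁ = proj₂ (avoidingTriangle rich₁ w)
      t₁-avoids = avoids {t₁} w∉t₁
      t₂ = proj₁ (avoidingTriangle rich₂ z)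
      z∉t₂ = proj₂ (avoidingTriangle rich₂ z)

    vertexPairs : VertexAvoiding H
    vertexPairs w with ι-view w
    ... | inj₂ (j , refl) = weakenPair (λ inside → inside {j}) pairA
    ... | inj₁ (u , refl) with u ≟ x | u ≟ y
    ...   | yes refl | _ = pairAvoidingEnd (λ x∉t → x∉t ∘ proj₁)
    ...   | no _ | yes refl = pairAvoidingEnd (λ y∉t → y∉t ∘ proj₂)
    ...   | no u≢x | no u≢y =
      weakenPair (λ meets ι₁u∈ → [ u≢x , u≢y ] (MeetsG₂.g₁-vertex-end meets ι₁u∈)) pairB

module Isomorphism {n n′} {G : Graph n} {H : Graph n′} (iso : G ≅ H) where

  open _≅_ iso
  open Inverse bij using (to; from; strictlyInverseˡ)

  from-hom : Homomorphism {G = H} G from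
  from-hom {u} {v} uv = begin
    E G (from u) (from v)             ≡⟨ preserve (from u) (from v) ⟨
    E H (to (from u)) (to (from v))   ≡⟨ cong₂ (E H) (strictlyInverseˡ u) (strictlyInverseˡ v) ⟩
    E H u v                           ≡⟨ uv ⟩
    true                              ∎
    where open ≡-Reasoning

  from-injective : Injective _≡_ _≡_ from
  from-injective = Injection.injective (↔⇒↣ (↔-sym bij))

  pullᵗ : Triangle H → Triangle G
  pullᵗ t = mapᵗ G from t (hom-preserves G from from-hom t)

  to-∈-pullᵗ : ∀ t {w} → w ∈ᵗ pullᵗ t → to w ∈ᵗ t
  to-∈-pullᵗ t w∈ with ∈-mapᵗ⁻ G from t (hom-preserves G from from-hom t) w∈
  ... | u , u∈t , refl = subst (_∈ᵗ t) (sym (strictlyInverseˡ u)) u∈t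

  pullᵗ-≉ : ∀ t t′ → t ≉ᵗ t′ → pullᵗ t ≉ᵗ pullᵗ t′
  pullᵗ-≉ t t′ = mapᵗ-≉ G from from-injective {t} {t′} (hom-preserves G from from-hom t) (hom-preserves G from from-hom t′)

  pullPair : ∀ {P : Triangle H → Set} {P′ : Triangle G → Set} →
             (∀ t → P t → P′ (pullᵗ t)) → TrianglePair H P → TrianglePair G P′
  pullPair = mapPair G from from-injective (λ t _ → hom-preserves G from from-hom t)

  pullDistinct : ∀ {k} → DistinctTriangles H k → DistinctTriangles G k
  pullDistinct (distinctTriangles ts refl ts-distinct) = distinctTriangles (map pullᵗ ts) (length-map pullᵗ ts)
    (AllPairs.map⁺ (AllPairs.map (λ {t} {t′} → pullᵗ-≉ t t′) ts-distinct))

  pullEdgeAvoiding : EdgeAvoiding H → EdgeAvoiding G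
  pullEdgeAvoiding edgePairs {x} {y} xy = pullPair avoids (edgePairs (trans (preserve x y) xy))
    where
    avoids : ∀ t → AvoidsEdge (to x) (to y) t → AvoidsEdge x y (pullᵗ t)
    avoids t avoids-t (x∈ , y∈) = avoids-t (to-∈-pullᵗ t x∈ , to-∈-pullᵗ t y∈)

  pullVertexAvoiding : VertexAvoiding H → VertexAvoiding G
  pullVertexAvoiding vertexPairs w = pullPair (λ t w∉t → w∉t ∘ to-∈-pullᵗ t) (vertexPairs (to w))

Ore4⇒TriangleRich : ∀ {n} {G : Graph n} → Ore4 G → TriangleRich G
Ore4⇒TriangleRich (isK4 iso) = ≅K4⇒TriangleRich iso
Ore4⇒TriangleRich (isOre {G₁ = G₁} {G₂} ore₁ ore₂ x y xy z side _ iso) = record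
  { four        = pullDistinct (four rich₁ rich₂)
  ; edgePairs   = pullEdgeAvoiding (edgePairs rich₁ rich₂)
  ; vertexPairs = inj₂ (pullVertexAvoiding (vertexPairs rich₁ rich₂))
  }
  where
  open Isomorphism iso
  open OreComposition G₁ x y xy G₂ z side
  rich₁ = Ore4⇒TriangleRich ore₁
  rich₂ = Ore4⇒TriangleRich ore₂

TriangleRich⇒split : ∀ {n} {G : Graph n} → TriangleRich G → ∀ z side → 2 ≤ triangles (split G z side)
TriangleRich⇒split {suc m} rich z side = pair⇒2≤triangles (splitPair rich z side)

TriangleRich⇒delete : ∀ {n} {G : Graph n} → TriangleRich G → ¬ (G ≅ K4) → ∀ z → 2 ≤ triangles (delete G z)
TriangleRich⇒delete {suc m} {G} rich G≇K4 z with TriangleRich.vertexPairs rich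
... | inj₁ G≅K4 = ⊥-elim (G≇K4 G≅K4)
... | inj₂ pairs = pair⇒2≤triangles (Deletion.restrictPair G z (pairs z))

claim8 : ∀ {n} (G : Graph n) → Ore4 G →
    (4 ≤ triangles G)
    × (∀ (z : Fin n) (side : Fin n → Bool) → IsSplit G z side →
         2 ≤ triangles (split G z side))
    × (¬ (G ≅ K4) → ∀ (z : Fin n) → 2 ≤ triangles (delete G z))
    × (G ≅ K4 → ∀ (z : Fin n) → triangles (delete G z) ≡ 1)
claim8 G ore =
  distinct⇒k≤triangles (TriangleRich.four rich) ,
  (λ z side _ → TriangleRich⇒split rich z side) ,
  TriangleRich⇒delete rich ,
  ≅K4⇒triangles-delete
  where
  rich = Ore4⇒TriangleRich ore
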